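{- For all formulas $\varphi,\psi,\chi$, the following sequents are derivable in $\mathtt{CHC}$: (1) $\varphi\rightarrow\psi,\varphi\rightarrow\neg\psi\blacktriangleright$ (empty succedent); (2) $\blacktriangleright(\varphi\rightarrow\psi)\rightarrow\neg(\varphi\rightarrow\neg\psi)$; (3) $\varphi\rightarrow\psi,\psi\rightarrow\chi\blacktriangleright\varphi\rightarrow\chi$; (4) $\varphi\rightarrow\psi\blacktriangleright(\psi\rightarrow\chi)\rightarrow(\varphi\rightarrow\chi)$.
   Context: Formulas are built from variables with binary $\wedge,\vee,\rightarrow$ and constants $0,1$; $\neg\alpha:=\alpha\rightarrow 0$. A sequent $\Gamma\blacktriangleright\Pi$ is a pair of a finite set $\Gamma$ of formulas and a set $\Pi$ that is empty or a singleton; commas denote union. $\mathtt{CHC}$ has axioms (id) $\alpha\blacktriangleright\alpha$; (0) $0\blacktriangleright$; (1) $\blacktriangleright 1$; rules (w-l) $\Gamma\blacktriangleright\Pi/\alpha,\Gamma\blacktriangleright\Pi$; (w-r) $\Gamma\blacktriangleright/\Gamma\blacktriangleright\alpha$; (cut) $\Gamma\blacktriangleright\alpha$, $\alpha,\Delta\blacktriangleright\Pi/\Gamma,\Delta\blacktriangleright\Pi$; ($\wedge$-l) $\alpha,\Gamma\blacktriangleright\Pi/\alpha\wedge\beta,\Gamma\blacktriangleright\Pi$ and $\beta,\Gamma\blacktriangleright\Pi/\alpha\wedge\beta,\Gamma\blacktriangleright\Pi$; ($\wedge$-r) $\Gamma\blacktriangleright\alpha$, $\Gamma\blacktriangleright\beta/\Gamma\blacktriangleright\alpha\wedge\beta$;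 ($\vee$-r) $\Gamma\blacktriangleright\alpha/\Gamma\blacktriangleright\alpha\vee\beta$ and $\Gamma\blacktriangleright\beta/\Gamma\blacktriangleright\alpha\vee\beta$; ($\vee$-l) $\alpha,\Gamma\blacktriangleright\Pi$, $\beta,\Gamma\blacktriangleright\Pi/\alpha\vee\beta,\Gamma\blacktriangleright\Pi$; ($\rightarrow$-l(a)) $\Gamma\blacktriangleright\alpha$, $\Delta,\beta\blacktriangleright\Pi/\Delta,\Gamma,\alpha\rightarrow\beta\blacktriangleright\Pi$; ($\rightarrow$-l(b)) $\neg\alpha,\Gamma\blacktriangleright\beta$, $\Delta,\alpha,\beta\blacktriangleright/\Gamma,\Delta,\alpha\rightarrow\beta\blacktriangleright$; ($\rightarrow$-r) $\alpha,\Gamma\blacktriangleright\beta$, $\Delta,\neg\alpha,\beta\blacktriangleright/\Gamma,\Delta\blacktriangleright\alpha\rightarrow\beta$. -}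

module Defs where

open import Data.Nat using (ℕ)
open import Data.List using (List; []; _∷_; _++_)
open import Data.List.Membership.Propositional using (_∈_)
open import Data.Maybe using (Maybe; just; nothing)
open import Data.Product using (_×_)

data Formula : Set where
  var  : ℕ → Formula
  `0   : Formula
  `1   : Formula
  _∧′_ : Formula → Formula → Formula
  _∨′_ : Formula → Formula → Formula
  _⇒_  : Formula → Formula → Formula

infixr 6 _∧′_
infixr 5 _∨′_
infixr 4 _⇒_

¬′_ : Formula → Formula
¬′ α = α ⇒ `0

infix 7 ¬′_

-- Antecedents are finite SETS of formulas; we represent them as lists and
-- identify lists with the same elements (rule `set-eq` below).  A comma
-- denotes union, i.e. list concatenation / cons modulo this identification.
_≈ₛ_ : List Formula → List Formula → Set
Γ ≈ₛ Δ = (∀ {x} → x ∈ Γ → x ∈ Δ) × (∀ {x} → x ∈ Δ → x ∈ Γ)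

-- Succedent: empty (nothing) or a singleton (just α).
Succ : Set
Succ = Maybe Formula

infix 2 _▶_

data _▶_ : List Formula → Succ → Set where
  set-eq : ∀ {Γ Δ Π} → Γ ≈ₛ Δ → Γ ▶ Π → Δ ▶ Π
  ax-id  : ∀ {α} → (α ∷ []) ▶ just α
  ax-0   : (`0 ∷ []) ▶ nothing
  ax-1   : [] ▶ just `1
  w-l    : ∀ {α Γ Π} → Γ ▶ Π → (α ∷ Γ) ▶ Π
  w-r    : ∀ {α Γ} → Γ ▶ nothing → Γ ▶ just α
  cut    : ∀ {α Γ Δ Π} → Γ ▶ just α → (α ∷ Δ) ▶ Π → (Γ ++ Δ) ▶ Π
  ∧-l₁   : ∀ {α β Γ Π} → (α ∷ Γ) ▶ Π → ((α ∧′ β) ∷ Γ) ▶ Π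
  ∧-l₂   : ∀ {α β Γ Π} → (β ∷ Γ) ▶ Π → ((α ∧′ β) ∷ Γ) ▶ Π
  ∧-r    : ∀ {α β Γ} → Γ ▶ just α → Γ ▶ just β → Γ ▶ just (α ∧′ β)
  ∨-r₁   : ∀ {α β Γ} → Γ ▶ just α → Γ ▶ just (α ∨′ β)
  ∨-r₂   : ∀ {α β Γ} → Γ ▶ just β → Γ ▶ just (α ∨′ β)
  ∨-l    : ∀ {α β Γ Π} → (α ∷ Γ) ▶ Π → (β ∷ Γ) ▶ Π → ((α ∨′ β) ∷ Γ) ▶ Π
  ⇒-la   : ∀ {α β Γ Δ Π} → Γ ▶ just α → (β ∷ Δ) ▶ Π
           → ((α ⇒ β) ∷ (Δ ++ Γ)) ▶ Π
  ⇒-lb   : ∀ {α β Γ Δ} → (¬′ α ∷ Γ) ▶ just β → (α ∷ β ∷ Δ) ▶ nothing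
           → ((α ⇒ β) ∷ (Γ ++ Δ)) ▶ nothing
  ⇒-r    : ∀ {α β Γ Δ} → (α ∷ Γ) ▶ just β → (¬′ α ∷ β ∷ Δ) ▶ nothing
           → (Γ ++ Δ) ▶ just (α ⇒ β)

{-# OPTIONS --safe #-}
module Submission where

open import Defs
open import Data.List using (List; []; _∷_; _++_)
open import Data.List.Membership.Propositional using (_∈_)
open import Data.List.Membership.Propositional.Properties using (∈-++⁻)
open import Data.List.Relation.Binary.Subset.Propositional using (_⊆_)
open import Data.List.Relation.Binary.Subset.Propositional.Properties using (xs⊆xs++ys)
open import Data.List.Relation.Unary.Any using (here; there)
open import Data.Maybe using (Maybe; just; nothing)
open import Data.Product using (_×_; _,_)
open import Data.Sum using ([_,_])
open import Function using (id)
open import Relation.Binary.PropositionalEquality using (refl)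

-- Since antecedents are sets, weakening and contraction are admissible, so every
-- rule may be used with one shared context Γ in which the principal formula is
-- merely a member. In that form the four sequents are short derivations; the
-- connexive ingredient is that α ⇒ β, ¬α and β are jointly inconsistent (⇒-lb).

pattern #0 = here refl
pattern #1 = there #0
pattern #2 = there #1
pattern #3 = there #2

private
  variable
    α β γ : Formula
    Γ Δ : List Formula
    Π : Maybe Formula

weaken-++ : ∀ Δ → Γ ▶ Π → (Δ ++ Γ) ▶ Π
weaken-++ []      d = d
weaken-++ (_ ∷ Δ) d = w-l (weaken-++ Δ d)

++-⊆ : Γ ⊆ Δ → (Δ ++ Γ) ⊆ Δ
++-⊆ {Δ = Δ} Γ⊆Δ p = [ id , Γ⊆Δ ] (∈-++⁻ Δ p)

▶-mono : Γ ⊆ Δ → Γ ▶ Π → Δ ▶ Π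
▶-mono {Δ = Δ} Γ⊆Δ d = set-eq (++-⊆ Γ⊆Δ , xs⊆xs++ys Δ _) (weaken-++ Δ d)

∷-++-self-⊆ : α ∈ Γ → (α ∷ Γ ++ Γ) ⊆ Γ
∷-++-self-⊆ α∈Γ #0        = α∈Γ
∷-++-self-⊆ α∈Γ (there p) = ++-⊆ id p

assumption : α ∈ Γ → Γ ▶ just α
assumption α∈Γ = ▶-mono (λ { #0 → α∈Γ }) ax-id

falsum : `0 ∈ Γ → Γ ▶ nothing
falsum 0∈Γ = ▶-mono (λ { #0 → 0∈Γ }) ax-0

cut′ : Γ ▶ just α → (α ∷ Γ) ▶ Π → Γ ▶ Π
cut′ d e = ▶-mono (++-⊆ id) (cut d e)

⇒-la′ : (α ⇒ β) ∈ Γ → Γ ▶ just α → (β ∷ Γ) ▶ Π → Γ ▶ Π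
⇒-la′ p d e = ▶-mono (∷-++-self-⊆ p) (⇒-la d e)

⇒-lb′ : (α ⇒ β) ∈ Γ → (¬′ α ∷ Γ) ▶ just β → (α ∷ β ∷ Γ) ▶ nothing → Γ ▶ nothing
⇒-lb′ p d e = ▶-mono (∷-++-self-⊆ p) (⇒-lb d e)

⇒-r′ : (α ∷ Γ) ▶ just β → (¬′ α ∷ β ∷ Γ) ▶ nothing → Γ ▶ just (α ⇒ β)
⇒-r′ d e = ▶-mono (++-⊆ id) (⇒-r d e)

¬-r : (α ∷ Γ) ▶ nothing → Γ ▶ just (¬′ α)
¬-r d = ⇒-r′ (w-r d) (falsum #1)

¬-l : ¬′ α ∈ Γ → Γ ▶ just α → Γ ▶ nothing
¬-l p d = ⇒-la′ p d (falsum #0)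

contradiction : α ∈ Γ → ¬′ α ∈ Γ → Γ ▶ nothing
contradiction p q = ¬-l q (assumption p)

⇒-¬antecedent-consequent-inconsistent : (α ⇒ β) ∈ Γ → ¬′ α ∈ Γ → β ∈ Γ → Γ ▶ nothing
⇒-¬antecedent-consequent-inconsistent p q r =
  ⇒-lb′ p (assumption (there r)) (contradiction #0 (there (there q)))

consequent-⇒ : β ∈ Γ → α ∈ Γ → Γ ▶ just (α ⇒ β)
consequent-⇒ p q = ⇒-r′ (assumption (there p)) (contradiction (there (there q)) #0)

¬⇒-⇒¬ : ¬′ (α ⇒ β) ∈ Γ → Γ ▶ just (α ⇒ ¬′ β)
¬⇒-⇒¬ p = ⇒-r′ (¬-r (¬-l (there (there p)) (consequent-⇒ #0 #1)))
                (¬-l (there (there p)) (⇒-r′ (w-r (contradiction #0 #1))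
                                             (contradiction #1 #3)))

⇒-⇒¬-inconsistent : (α ⇒ β) ∈ Γ → (α ⇒ ¬′ β) ∈ Γ → Γ ▶ nothing
⇒-⇒¬-inconsistent p q =
  ⇒-lb′ q (¬-r (⇒-¬antecedent-consequent-inconsistent (there (there p)) #1 #0))
          (⇒-la′ (there (there p)) (assumption #0) (contradiction #0 #2))

⇒-trans : (α ⇒ β) ∈ Γ → (β ⇒ γ) ∈ Γ → Γ ▶ just (α ⇒ γ)
⇒-trans p q =
  ⇒-r′ (⇒-la′ (there p) (assumption #0)
                (⇒-la′ (there (there q)) (assumption #0) (assumption #0)))
       (⇒-lb′ (there (there q)) (assumption #2)
              (⇒-¬antecedent-consequent-inconsistent (there (there (there (there p)))) #2 #0))

boethius : Γ ▶ just ((α ⇒ β) ⇒ ¬′ (α ⇒ ¬′ β))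
boethius = ⇒-r′ (¬-r (⇒-⇒¬-inconsistent #1 #0)) (¬-l #1 (¬⇒-⇒¬ #0))

-- The second premise of ⇒-r: ¬(β ⇒ γ) gives β ⇒ ¬γ, hence α ⇒ ¬γ, clashing with α ⇒ γ.
⇒-trans-curried : (α ⇒ β) ∈ Γ → Γ ▶ just ((β ⇒ γ) ⇒ (α ⇒ γ))
⇒-trans-curried p =
  ⇒-r′ (⇒-trans (there p) #0)
       (cut′ (¬⇒-⇒¬ #0)
             (cut′ (⇒-trans (there (there (there p))) #0) (⇒-⇒¬-inconsistent #3 #0)))

lemma4p6 : (φ ψ χ : Formula)
    → (((φ ⇒ ψ) ∷ (φ ⇒ ¬′ ψ) ∷ []) ▶ nothing)
    × ([] ▶ just ((φ ⇒ ψ) ⇒ ¬′ (φ ⇒ ¬′ ψ)))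
    × (((φ ⇒ ψ) ∷ (ψ ⇒ χ) ∷ []) ▶ just (φ ⇒ χ))
    × (((φ ⇒ ψ) ∷ []) ▶ just ((ψ ⇒ χ) ⇒ (φ ⇒ χ)))
lemma4p6 φ ψ χ = ⇒-⇒¬-inconsistent #0 #1 , boethius , ⇒-trans #0 #1 , ⇒-trans-curried #0
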